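{- Let $x_1,\ldots,x_n,y$ be distinct bitvector variables and let $\mathcal M$ be an assignment of bitvector values to $x_1,\ldots,x_n$ (not to $y$). Let $E$ be a finite set of equalities and $D$ a finite set of disequalities between bitvector terms of the grammar $t ::= e \mid y[h:l] \mid t\circ t$, where $e$ ranges over evaluable terms, such that every literal of $E\cup D$ has its variables among $x_1,\ldots,x_n,y$ and contains $y$. Assume $E\cup D$ is a conflict core at $\mathcal M$: the formula $\exists y\,(\bigwedge E\wedge\bigwedge D)$ evaluates to false under $\mathcal M$, while for every proper subset $\Gamma\subsetneq E\cup D$ the formula $\exists y\,\bigwedge\Gamma$ evaluates to true under $\mathcal M$. Let $F:=\bigwedge E\wedge\bigwedge D$. Let $\widehat E$ and $\widehat D$ be sliced forms of $E$ and $D$: there is a family of pairwise disjoint bit ranges of $y$ (the slices $y[h:l]$), $\widehat E$ is a set of equalities and $\widehat D$ is a set of clauses (disjunctions of disequalities), every side of every literal in $\widehat E\cup\widehat D$ is either an evaluable term whose variables occur in $F$ or one of these slices, $\bigwedge E\Leftrightarrow\bigwedge\widehat E$ is valid, and $\widehat D$ consists of exactly one clause for each disequality of $D$, equivalent (validly) to that disequality. Algorithm A (E-graph). Initially every term occurring in $\widehat E\cup\widehat D$ forms its own component, being its own representative $\mathrm{rep}(\cdot)$. The equalities $t_1\approx t_2$ of $\widehat E$ are processed one by one: let $t_1'=\mathrm{rep}(t_1)$, $t_2'=\mathrm{rep}(t_2)$; if $t_1',t_2'$ are both evaluable and $[\![t_1']\!]_{\mathcal M}\neq[\![t_2']\!]_{\mathcal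 M}$, Algorithm A stops and raises a conflict on $(t_1',t_2')$; otherwise the two components are merged and the representative of the merged component is one of $t_1',t_2'$, chosen to be evaluable whenever one of them is evaluable. If all equalities are processed, it returns the resulting partition $\mathcal G$. Algorithm B (disequalities), run with the $\mathcal G$ returned by Algorithm A. For a clause $C\in\widehat D$, each disequality $t_1\not\approx t_2$ in $C$ is placed in: $C_{E}$ if $\mathrm{rep}(t_1)=\mathrm{rep}(t_2)$; $C_{\mathcal M}$ if the representatives are distinct, both evaluable, and have equal values under $\mathcal M$; $C_{\mathrm{interface}}$ if the representatives are distinct, one evaluable and the other a slice; $C_{\mathrm{free}}$ if the representatives are two distinct slices. Start with $S:=\emptyset$ and $C_0:=$ the empty disjunction. For each clause $C\in\widehat D$ in turn, let $C^{\mathrm{rep}}_{\mathcal M}:=\bigvee\{\mathrm{rep}(t_1)\not\approx\mathrm{rep}(t_2)\mid (t_1\not\approx t_2)\in C_{\mathcal M}\}$. If $C_{\mathrm{interface}}$ and $C_{\mathrm{free}}$ are both empty, Algorithm B stops and outputs $C^{\mathrm{rep}}_{\mathcal M}$. Otherwise set $C_0:=C_0\vee C^{\mathrm{rep}}_{\mathcal M}$ and add to $S$ the evaluable representative of each disequality of $C_{\mathrm{interface}}$. If all clauses are processed, let $C_{\neq}:=\bigvee\{s_1\approx s_2\mid s_1,s_2\in S,\ [\![s_1]\!]_{\mathcal M}\neq[\![s_2]\!]_{\mathcal M}\}$ and $C_{=}:=\bigvee\{s_1\not\approx s_2\mid s_1,s_2\in S,\ s_1\neq s_2,\ [\![s_1]\!]_{\mathcal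 M}=[\![s_2]\!]_{\mathcal M}\}$, and output $C_0\vee C_{\neq}\vee C_{=}$. Then: (1) if Algorithm A raises a conflict on $(t_1',t_2')$, the literal $t_1'\approx t_2'$ is an interpolant for $F$ at $\mathcal M$; (2) if Algorithm A returns $\mathcal G$ and Algorithm B stops at some clause $C$, then $C^{\mathrm{rep}}_{\mathcal M}$ is an interpolant for $F$ at $\mathcal M$; (3) if Algorithm A returns $\mathcal G$ and Algorithm B processes all clauses, then $C_0\vee C_{\neq}\vee C_{=}$ is an interpolant for $F$ at $\mathcal M$.
   Context: We work in the quantifier-free theory of fixed-size bitvectors. For a bitvector term $u$ of bitwidth $n$ and integers $0\le l<h\le n$, $u[h:l]$ denotes the extraction of the bits of $u$ at indices $l,\ldots,h-1$ (bit $0$ is the right-most bit); $u\circ v$ denotes concatenation. A term is evaluable if $y$ does not occur in it; $[\![e]\!]_{\mathcal M}$ is its value under $\mathcal M$. Interpolant: a clause $I$ is an interpolant for a formula $F$ at the assignment $\mathcal M$ (assigning $x_1,\ldots,x_n$) if (i) $F\Rightarrow I$ is valid in the bitvector theory, (ii) every variable of $I$ belongs to $\{x_1,\ldots,x_n\}$ and occurs in $F$, and (iii) $I$ evaluates to false under $\mathcal M$. -}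

module Defs where

open import Level using (0ℓ)
open import Data.Nat using (ℕ; zero; suc; _+_; _∸_; _<_; _≤_)
open import Data.Fin using (Fin; toℕ)
open import Data.Bool using (Bool; false)
open import Data.Vec using (Vec; []; _∷_; tabulate) renaming (_++_ to _++ᵥ_)
open import Data.List using (List; []; _∷_; map; length; lookup) renaming (_++_ to _++ˡ_)
open import Data.List.Membership.Propositional using (_∈_; _∉_)
open import Data.List.Relation.Unary.All using (All)
open import Data.List.Relation.Unary.Any using (Any)
open import Data.List.Relation.Binary.Pointwise using (Pointwise)
open import Data.Product using (Σ; _×_; _,_; proj₁; proj₂)
open import Data.Sum using (_⊎_)
open import Data.Empty using (⊥-elim)
open import Relation.Nullary using (¬_)
open import Relation.Binary.PropositionalEquality using (_≡_; _≢_)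
open import Function.Bundles using (_⇔_)

-- A bitvector of width n is a Vec Bool n stored MSB-first:
-- position 0 of the vector is bit n-1, the last position is bit 0.
-- Hence concatenation u ∘ v (u the high part) is plain vector append.

BV : ℕ → Set
BV n = Vec Bool n

-- value at vector position p (false out of range; never used out of range
-- for well-formed extractions)
atPos : ∀ {n} → BV n → ℕ → Bool
atPos []      _       = false
atPos (b ∷ v) zero    = b
atPos (b ∷ v) (suc p) = atPos v p

-- u[h:l] : bits l .. h-1 of u (bit 0 = right-most).  Bit h-1 of u sits at
-- position n-h, so the result (MSB-first) is positions n-h .. n-l-1.
extractBV : ∀ {n} (h l : ℕ) → BV n → BV (h ∸ l)
extractBV {n} h l u = tabulate (λ p → atPos u ((n ∸ h) + toℕ p))

concatBV : ∀ {a b} → BV a → BV b → BV (a + b)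
concatBV u v = u ++ᵥ v

-- The variables x_1..x_k (widths wx) and the distinguished variable y
-- (width wy).  They are distinct by construction.

record Vars : Set where
  field
    k     : ℕ
    wx    : Fin k → ℕ
    wy    : ℕ
    wx-pos : ∀ i → 1 ≤ wx i
    wy-pos : 1 ≤ wy

module _ (V : Vars) where
  open Vars V

  data Var : Set where
    x : Fin k → Var
    y : Var

  -- Bitvector terms.  Arbitrary bitvector function symbols (bvadd, bvmul,
  -- bvnot, shifts, ...) are represented by their semantic functions
  -- (unary op1 / binary op2); constants by cst.
  data Tm : ℕ → Set where
    var  : (i : Fin k) → Tm (wx i)
    yvar : Tm wy
    cst  : ∀ {m} → BV m → Tm m
    ext  : ∀ {n} (h l : ℕ) → .(l < h) → .(h ≤ n) → Tm n → Tm (h ∸ l)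
    cat  : ∀ {a b} → Tm a → Tm b → Tm (a + b)
    op1  : ∀ {a m} → (BV a → BV m) → Tm a → Tm m
    op2  : ∀ {a b m} → (BV a → BV b → BV m) → Tm a → Tm b → Tm m

  ATm : Set
  ATm = Σ ℕ Tm

  ⟪_⟫ : ∀ {w} → Tm w → ATm
  ⟪_⟫ {w} t = w , t

  data Occ : Var → ∀ {w} → Tm w → Set where
    o-x    : ∀ i → Occ (x i) (var i)
    o-y    : Occ y yvar
    o-ext  : ∀ {v n h l} .{p : l < h} .{q : h ≤ n} {t : Tm n} →
             Occ v t → Occ v (ext h l p q t)
    o-catˡ : ∀ {v a b} {t : Tm a} {u : Tm b} → Occ v t → Occ v (cat t u)
    o-catʳ : ∀ {v a b} {t : Tm a} {u : Tm b} → Occ v u → Occ v (cat t u)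
    o-op1  : ∀ {v a m} {f : BV a → BV m} {t : Tm a} → Occ v t → Occ v (op1 f t)
    o-op2ˡ : ∀ {v a b m} {f : BV a → BV b → BV m} {t : Tm a} {u : Tm b} →
             Occ v t → Occ v (op2 f t u)
    o-op2ʳ : ∀ {v a b m} {f : BV a → BV b → BV m} {t : Tm a} {u : Tm b} →
             Occ v u → Occ v (op2 f t u)

  Evaluable : ∀ {w} → Tm w → Set
  Evaluable t = ¬ Occ y t

  Asg : Set
  Asg = (i : Fin k) → BV (wx i)

  eval : ∀ {w} → Asg → BV wy → Tm w → BV w
  eval ρ yv (var i)           = ρ i
  eval ρ yv yvar              = yv
  eval ρ yv (cst c)           = c
  eval ρ yv (ext h l _ _ t)   = extractBV h l (eval ρ yv t)
  eval ρ yv (cat t u)         = concatBV (eval ρ yv t) (eval ρ yv u)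
  eval ρ yv (op1 f t)         = f (eval ρ yv t)
  eval ρ yv (op2 f t u)       = f (eval ρ yv t) (eval ρ yv u)

  evalE : ∀ {w} → Asg → (t : Tm w) → Evaluable t → BV w
  evalE M (var i) e         = M i
  evalE M yvar e            = ⊥-elim (e o-y)
  evalE M (cst c) e         = c
  evalE M (ext h l _ _ t) e = extractBV h l (evalE M t (λ o → e (o-ext o)))
  evalE M (cat t u) e       = concatBV (evalE M t (λ o → e (o-catˡ o)))
                                       (evalE M u (λ o → e (o-catʳ o)))
  evalE M (op1 f t) e       = f (evalE M t (λ o → e (o-op1 o)))
  evalE M (op2 f t u) e     = f (evalE M t (λ o → e (o-op2ˡ o)))
                                (evalE M u (λ o → e (o-op2ʳ o)))

  data Lit : Set where
    _≐_ : ∀ {w} → Tm w → Tm w → Lit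
    _≉_ : ∀ {w} → Tm w → Tm w → Lit

  holdsL : Asg → BV wy → Lit → Set
  holdsL ρ yv (t ≐ u) = eval ρ yv t ≡ eval ρ yv u
  holdsL ρ yv (t ≉ u) = eval ρ yv t ≢ eval ρ yv u

  OccL : Var → Lit → Set
  OccL v (t ≐ u) = Occ v t ⊎ Occ v u
  OccL v (t ≉ u) = Occ v t ⊎ Occ v u

  Eqn : Set
  Eqn = Σ ℕ λ w → Tm w × Tm w

  eqLit : Eqn → Lit
  eqLit (w , t , u) = t ≐ u

  neqLit : Eqn → Lit
  neqLit (w , t , u) = t ≉ u

  lhs : (e : Eqn) → Tm (proj₁ e)
  lhs (w , t , u) = t

  rhs : (e : Eqn) → Tm (proj₁ e)
  rhs (w , t , u) = u

  HoldsEq : Asg → BV wy → Eqn → Set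
  HoldsEq ρ yv e = holdsL ρ yv (eqLit e)

  HoldsNeq : Asg → BV wy → Eqn → Set
  HoldsNeq ρ yv e = holdsL ρ yv (neqLit e)

  Clause : Set₁
  Clause = Lit → Set

  HoldsC : Asg → BV wy → Clause → Set
  HoldsC ρ yv C = Σ Lit λ l → C l × holdsL ρ yv l

  module _ (E D : List Eqn) where

    HoldsF : Asg → BV wy → Set
    HoldsF ρ yv = All (HoldsEq ρ yv) E × All (HoldsNeq ρ yv) D

    OccF : Fin k → Set
    OccF i = Any (λ e → OccL (x i) (eqLit e)) E ⊎ Any (λ d → OccL (x i) (neqLit d)) D

    litsF : List Lit
    litsF = map eqLit E ++ˡ map neqLit D

    Interpolant : Asg → Clause → Set
    Interpolant M I =
        (∀ ρ yv → HoldsF ρ yv → HoldsC ρ yv I)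
      × (∀ l → I l → ¬ OccL y l × (∀ i → OccL (x i) l → OccF i))
      × (∀ yv → ¬ HoldsC M yv I)

  data Gr : ∀ {w} → Tm w → Set where
    g-e   : ∀ {w} {t : Tm w} → Evaluable t → Gr t
    g-s   : ∀ {h l} .{p : l < h} .{q : h ≤ wy} → Gr (ext h l p q yvar)
    g-cat : ∀ {a b} {t : Tm a} {u : Tm b} → Gr t → Gr u → Gr (cat t u)

  LitOK : Eqn → Set
  LitOK e = Gr (lhs e) × Gr (rhs e) × OccL y (eqLit e)

  ConflictCore : Asg → List Eqn → List Eqn → Set
  ConflictCore M E D =
      All LitOK E × All LitOK D
    × (¬ Σ (BV wy) λ yv → HoldsF E D M yv)
    × (∀ (Γ : List Lit) → (∀ {l} → l ∈ Γ → l ∈ litsF E D)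
         → (Σ Lit λ l → l ∈ litsF E D × l ∉ Γ)
         → Σ (BV wy) λ yv → All (holdsL M yv) Γ)

  Slice : Set
  Slice = Σ ℕ λ h → Σ ℕ λ l → (l < h) × (h ≤ wy)

  sliceTm : (s : Slice) → Tm (proj₁ s ∸ proj₁ (proj₂ s))
  sliceTm (h , l , p , q) = ext h l p q yvar

  Disjoint : List Slice → Set
  Disjoint Sl = ∀ (i j : Fin (length Sl)) → i ≢ j →
    proj₁ (lookup Sl i) ≤ proj₁ (proj₂ (lookup Sl j))
    ⊎ proj₁ (lookup Sl j) ≤ proj₁ (proj₂ (lookup Sl i))

  IsSlice : List Slice → ∀ {w} → Tm w → Set
  IsSlice Sl t = Σ Slice λ s → s ∈ Sl × ⟪ sliceTm s ⟫ ≡ ⟪ t ⟫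

  module _ (E D : List Eqn) (Sl : List Slice) where

    SideOK : ∀ {w} → Tm w → Set
    SideOK t = (Evaluable t × (∀ i → Occ (x i) t → OccF E D i)) ⊎ IsSlice Sl t

    EqnOK : Eqn → Set
    EqnOK e = SideOK (lhs e) × SideOK (rhs e)

    SlicedForms : List Eqn → List (List Eqn) → Set
    SlicedForms Ê D̂ =
        Disjoint Sl
      × All EqnOK Ê
      × All (All EqnOK) D̂
      × (∀ ρ yv → All (HoldsEq ρ yv) E ⇔ All (HoldsEq ρ yv) Ê)
      × Pointwise (λ d C → ∀ ρ yv → HoldsNeq ρ yv d ⇔ Any (HoldsNeq ρ yv) C) D D̂

  -- Algorithm A (E-graph).  A state is the representative map rep;
  -- components are the classes {s | rep s = r}.  Initially rep = id.

  Rep : Set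
  Rep = ∀ {w} → Tm w → Tm w

  idRep : Rep
  idRep t = t

  Merge : Rep → ∀ {w₀} → Tm w₀ → Tm w₀ → Tm w₀ → Rep → Set
  Merge R r1 r2 c R' = ∀ {w} (s : Tm w) →
      ((⟪ R s ⟫ ≡ ⟪ r1 ⟫ ⊎ ⟪ R s ⟫ ≡ ⟪ r2 ⟫) → ⟪ R' s ⟫ ≡ ⟪ c ⟫)
    × (⟪ R s ⟫ ≢ ⟪ r1 ⟫ → ⟪ R s ⟫ ≢ ⟪ r2 ⟫ → R' s ≡ R s)

  Clash : Asg → ∀ {w} → Tm w → Tm w → Set
  Clash M a b = Σ (Evaluable a) λ p → Σ (Evaluable b) λ q → evalE M a p ≢ evalE M b q

  data ResA : Set where
    conflict : ∀ {w} → Tm w → Tm w → ResA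
    graph    : Rep → ResA

  -- RunA M R es res : processing the equalities es (in order) from state R
  -- can end with result res (all admissible choices of representatives).
  data RunA (M : Asg) : Rep → List Eqn → ResA → Set where
    done  : ∀ {R : Rep} → RunA M R [] (graph R)
    stop  : ∀ {R : Rep} {w} {t1 t2 : Tm w} {es} →
            Clash M (R t1) (R t2) →
            RunA M R ((w , t1 , t2) ∷ es) (conflict (R t1) (R t2))
    merge : ∀ {R R' : Rep} {w} {t1 t2 : Tm w} {es res} (c : Tm w) →
            ¬ Clash M (R t1) (R t2) →
            (c ≡ R t1 ⊎ c ≡ R t2) →
            (Evaluable (R t1) ⊎ Evaluable (R t2) → Evaluable c) →
            Merge R (R t1) (R t2) c R' →
            RunA M R' es res →
            RunA M R ((w , t1 , t2) ∷ es) res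

  module _ (M : Asg) (Sl : List Slice) (G : Rep) where

    InCE : Eqn → Set
    InCE (w , t1 , t2) = G t1 ≡ G t2

    InCM : Eqn → Set
    InCM (w , t1 , t2) = G t1 ≢ G t2 ×
      (Σ (Evaluable (G t1)) λ p → Σ (Evaluable (G t2)) λ q → evalE M (G t1) p ≡ evalE M (G t2) q)

    InCint : Eqn → Set
    InCint (w , t1 , t2) = G t1 ≢ G t2 ×
      ((Evaluable (G t1) × IsSlice Sl (G t2)) ⊎ (IsSlice Sl (G t1) × Evaluable (G t2)))

    InCfree : Eqn → Set
    InCfree (w , t1 , t2) = G t1 ≢ G t2 × IsSlice Sl (G t1) × IsSlice Sl (G t2)

    NoIF : List Eqn → Set
    NoIF C = All (λ d → ¬ InCint d × ¬ InCfree d) C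

    repNeq : Eqn → Lit
    repNeq (w , t1 , t2) = G t1 ≉ G t2

    CrepM : List Eqn → Clause
    CrepM C l = Σ Eqn λ d → d ∈ C × InCM d × l ≡ repNeq d

    EvRep : Eqn → ATm → Set
    EvRep (w , t1 , t2) a = (a ≡ ⟪ G t1 ⟫ × Evaluable (G t1)) ⊎ (a ≡ ⟪ G t2 ⟫ × Evaluable (G t2))

    module _ (D̂ : List (List Eqn)) where

      -- the set S after all clauses are processed
      InS : ATm → Set
      InS a = Σ (List Eqn) λ C → C ∈ D̂ × Σ Eqn λ d → d ∈ C × InCint d × EvRep d a

      C₀ : Clause
      C₀ l = Σ (List Eqn) λ C → C ∈ D̂ × CrepM C l

      C≠ : Clause
      C≠ l = Σ ℕ λ w → Σ (Tm w) λ s1 → Σ (Tm w) λ s2 → InS ⟪ s1 ⟫ × InS ⟪ s2 ⟫ ×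
        (Σ (Evaluable s1) λ p → Σ (Evaluable s2) λ q → evalE M s1 p ≢ evalE M s2 q) ×
        l ≡ (s1 ≐ s2)

      C₌ : Clause
      C₌ l = Σ ℕ λ w → Σ (Tm w) λ s1 → Σ (Tm w) λ s2 → InS ⟪ s1 ⟫ × InS ⟪ s2 ⟫ ×
        s1 ≢ s2 ×
        (Σ (Evaluable s1) λ p → Σ (Evaluable s2) λ q → evalE M s1 p ≡ evalE M s2 q) ×
        l ≡ (s1 ≉ s2)

      FinalClause : Clause
      FinalClause l = C₀ l ⊎ C≠ l ⊎ C₌ l

module Submission where

-- Algorithm A is analysed through invariants of its representative map R:
-- representatives of evaluable terms are evaluable with the same value under
-- M, representatives of admissible sides are admissible, and in every model
-- of the processed equalities R preserves values.  Claim (1) follows at once: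
-- a conflict pair clashes at M but is equal in every model of F.  Minimality
-- of the conflict core shows that the representatives of a disequality of D̂
-- never clash at M, so a disequality true in a model of F lies in C_M,
-- C_interface or C_free; this gives claim (2).  For claim (3), suppose the
-- final clause is false in a model (ρ , yv) of F.  Then the S-entries have
-- equal values under ρ exactly when they have equal values under M, so an
-- injective relabelling of bitvectors (a product of transpositions) sends
-- ρ-values of entries to M-values.  Relabelling the values of the slice
-- representatives and assembling y from the disjoint slices gives a y with
-- M , y ⊨ F, contradicting the conflict core.

open import Level using (0ℓ)
open import Defs
open import Data.Nat as ℕ using (ℕ; zero; suc; _∸_; _+_; _<_; _≤_; s≤s; _≤?_; _<?_)
import Data.Nat.Properties as ℕₚ
open import Data.Fin as Fin using (Fin; toℕ)
import Data.Fin.Properties as Finₚ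
open import Data.Bool using (Bool; false)
import Data.Bool.Properties as Boolₚ
open import Data.Vec as Vec using (_∷_; tabulate)
import Data.Vec.Properties as Vecₚ
open import Data.Maybe using (Maybe; just; nothing)
open import Data.Maybe.Properties using (just-injective)
open import Data.List using (List; []; _∷_; map; lookup) renaming (_++_ to _++ˡ_)
open import Data.List.Membership.Propositional using (_∈_; find; lose)
open import Data.List.Membership.Propositional.Properties using (∈-++⁺ˡ; ∈-++⁺ʳ; ∈-map⁺; ∈-map⁻)
open import Data.List.Relation.Unary.All as All using (All; []; _∷_)
open import Data.List.Relation.Unary.Any as Any using (Any; here; there)
import Data.List.Relation.Unary.Any.Properties as Anyₚ
open import Data.List.Relation.Binary.Pointwise using (Pointwise; _∷_)
import Data.List.Relation.Binary.Pointwise.Properties as Pointwiseₚ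
open import Data.Product using (Σ; _×_; _,_; proj₁; proj₂; map₁)
open import Data.Sum using (_⊎_; inj₁; inj₂; [_,_])
open import Data.Empty using (⊥; ⊥-elim)
open import Function.Base using (id; _∘_)
open import Function.Bundles using (_⇔_; mk⇔; Equivalence)
open import Effect.Monad using (RawMonad)
open import Relation.Nullary using (¬_; Dec; yes; no)
open import Relation.Nullary.Decidable
  using (map′; _⊎-dec_; _×-dec_; decidable-stable; ¬¬-excluded-middle)
open import Relation.Nullary.Negation using (¬¬-Monad; ¬¬-map)
open import Relation.Binary.Definitions using (DecidableEquality)
open import Relation.Binary.PropositionalEquality
  using (_≡_; _≢_; refl; sym; trans; cong; cong₂; subst; subst₂; module ≡-Reasoning)
open ≡-Reasoning

-- Terms contain semantic function symbols, so syntactic equality of terms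
-- (hence of representatives) is undecidable.  Case splits on it are done in
-- the double-negation monad, which is left only towards stable goals.
open RawMonad (¬¬-Monad {0ℓ}) using (pure; _>>=_)

_≟ᵇᵛ_ : ∀ {n} → DecidableEquality (BV n)
_≟ᵇᵛ_ = Vecₚ.≡-dec Boolₚ._≟_

bv-stable : ∀ {n} {a b : BV n} → ¬ ¬ (a ≡ b) → a ≡ b
bv-stable {a = a} {b} = decidable-stable (a ≟ᵇᵛ b)

pair-injective : ∀ {I : Set} {A : I → Set} {i} {a b : A i} →
                 _≡_ {A = Σ I A} (i , a) (i , b) → a ≡ b
pair-injective refl = refl

-- Removing an element a from a list, given for each entry a decision of
-- whether it equals a (literals have no decidable equality, so these
-- decisions are obtained under double negation).
module _ {A : Set} (a : A) where

  without : (xs : List A) → All (λ z → Dec (z ≡ a)) xs → List A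
  without []       []           = []
  without (z ∷ xs) (yes _ ∷ ds) = without xs ds
  without (z ∷ xs) (no _  ∷ ds) = z ∷ without xs ds

  without-⊆ : ∀ xs ds {z} → z ∈ without xs ds → z ∈ xs × z ≢ a
  without-⊆ (_ ∷ xs) (yes _  ∷ ds) z∈          = map₁ there (without-⊆ xs ds z∈)
  without-⊆ (_ ∷ xs) (no z≢a ∷ ds) (here refl) = here refl , z≢a
  without-⊆ (_ ∷ xs) (no _   ∷ ds) (there z∈)  = map₁ there (without-⊆ xs ds z∈)

  without-⊇ : ∀ xs ds {z} → z ∈ xs → z ≢ a → z ∈ without xs ds
  without-⊇ (_ ∷ xs) (yes z≡a ∷ ds) (here refl) z≢a = ⊥-elim (z≢a z≡a)
  without-⊇ (_ ∷ xs) (yes _   ∷ ds) (there z∈)  z≢a = without-⊇ xs ds z∈ z≢a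
  without-⊇ (_ ∷ xs) (no _    ∷ ds) (here refl) _   = here refl
  without-⊇ (_ ∷ xs) (no _    ∷ ds) (there z∈)  z≢a = there (without-⊇ xs ds z∈ z≢a)

pointwise-partner : ∀ {A B : Set} {R : A → B → Set} {xs ys} → Pointwise R xs ys →
                    ∀ {b} → b ∈ ys → Σ A λ a → a ∈ xs × R a b
pointwise-partner (r ∷ rs) (here refl) = _ , here refl , r
pointwise-partner (r ∷ rs) (there b∈)  = let a , a∈ , r′ = pointwise-partner rs b∈ in a , there a∈ , r′

search : ∀ {A Out : Set} {Q : A → Set} → (∀ a → Out ⊎ Q a) → ∀ xs → Out ⊎ (∀ {a} → a ∈ xs → Q a)
search f []       = inj₂ λ ()
search f (a ∷ xs) with f a | search f xs
... | inj₁ out | _        = inj₁ out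
... | inj₂ _   | inj₁ out = inj₁ out
... | inj₂ q   | inj₂ qs  = inj₂ λ { (here refl) → q ; (there a∈) → qs a∈ }

-- Given pairs (aₖ , bₖ) in a family of types with decidable equality such
-- that aₖ = aₗ exactly when bₖ = bₗ, a product of transpositions is an
-- injective map sending every aₖ to bₖ.  It is used to relabel the values
-- of slices when a countermodel at M is built.
module Permutation {I : Set} (_≟ᴵ_ : DecidableEquality I)
                   (A : I → Set) (_≟_ : ∀ {i} → DecidableEquality (A i)) where

  swap : ∀ {i} → A i → A i → A i → A i
  swap a b v with v ≟ a | v ≟ b
  ... | yes _ | _     = b
  ... | no _  | yes _ = a
  ... | no _  | no _  = v

  swap-left : ∀ {i} (a b : A i) → swap a b a ≡ b
  swap-left a b with a ≟ a
  ... | yes _   = refl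
  ... | no a≢a  = ⊥-elim (a≢a refl)

  swap-right : ∀ {i} (a b : A i) → swap a b b ≡ a
  swap-right a b with b ≟ a | b ≟ b
  ... | yes b≡a | _       = b≡a
  ... | no _    | yes _   = refl
  ... | no _    | no b≢b  = ⊥-elim (b≢b refl)

  swap-fix : ∀ {i} (a b v : A i) → (v ≡ a → b ≡ v) → (v ≡ b → a ≡ v) → swap a b v ≡ v
  swap-fix a b v onA onB with v ≟ a | v ≟ b
  ... | yes v≡a | _       = onA v≡a
  ... | no _    | yes v≡b = onB v≡b
  ... | no _    | no _    = refl

  swap-involutive : ∀ {i} (a b v : A i) → swap a b (swap a b v) ≡ v
  swap-involutive a b v with v ≟ a | v ≟ b
  ... | yes refl | _        = swap-right v b
  ... | no _     | yes refl = swap-left a v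
  ... | no v≢a   | no v≢b   = swap-fix a b v (λ e → ⊥-elim (v≢a e)) (λ e → ⊥-elim (v≢b e))

  swap-injective : ∀ {i} (a b : A i) {u v : A i} → swap a b u ≡ swap a b v → u ≡ v
  swap-injective a b {u} {v} e =
    trans (sym (swap-involutive a b u)) (trans (cong (swap a b) e) (swap-involutive a b v))

  -- (i , a , b): the point a of A i is to be sent to b
  Pair : Set
  Pair = Σ I λ i → A i × A i

  realise : List Pair → ∀ i → A i → A i
  realise []                i v = v
  realise ((j , a , b) ∷ L) i v with j ≟ᴵ i
  ... | yes refl = swap (realise L j a) b (realise L j v)
  ... | no _     = realise L i v

  realise-injective : ∀ L i {u v : A i} → realise L i u ≡ realise L i v → u ≡ v
  realise-injective []                i e = e
  realise-injective ((j , a , b) ∷ L) i e with j ≟ᴵ i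
  ... | yes refl = realise-injective L j (swap-injective _ _ e)
  ... | no _     = realise-injective L i e

  Consistent : List Pair → Set
  Consistent L = ∀ {i a b j a′ b′} → (i , a , b) ∈ L → (j , a′ , b′) ∈ L →
    _≡_ {A = Σ I A} (i , a) (j , a′) ⇔ _≡_ {A = Σ I A} (i , b) (j , b′)

  consistent-tail : ∀ {p L} → Consistent (p ∷ L) → Consistent L
  consistent-tail con a∈ b∈ = con (there a∈) (there b∈)

  realise-maps : ∀ L → Consistent L → ∀ {i a b} → (i , a , b) ∈ L → realise L i a ≡ b
  realise-maps ((j , a , b) ∷ L) con (here refl) with j ≟ᴵ j
  ... | yes refl = swap-left (realise L j a) b
  ... | no j≢j   = ⊥-elim (j≢j refl)
  realise-maps ((j , a , b) ∷ L) con {i} {v} {c} (there v↦c) with j ≟ᴵ i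
  ... | no _     = realise-maps L (consistent-tail con) v↦c
  ... | yes refl =
    trans (cong (swap (realise L j a) b) v↦c′) (swap-fix (realise L j a) b c onA onB)
    where
      sameSource : (j , v) ≡ (j , a) ⇔ (j , c) ≡ (j , b)
      sameSource = con (there v↦c) (here refl)
      v↦c′ : realise L j v ≡ c
      v↦c′ = realise-maps L (consistent-tail con) v↦c
      onA : c ≡ realise L j a → b ≡ c
      onA e = sym (pair-injective (Equivalence.to sameSource
                (cong (j ,_) (realise-injective L j (trans v↦c′ e)))))
      onB : c ≡ b → realise L j a ≡ c
      onB e = trans (cong (realise L j)
                (sym (pair-injective (Equivalence.from sameSource (cong (j ,_) e))))) v↦c′

module Terms (V : Vars) where
  open Vars V

  occurs? : (v : Var V) → ∀ {w} (t : Tm V w) → Dec (Occ V v t)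
  occurs? (x j) (var i) with j Fin.≟ i
  ... | yes refl = yes (o-x i)
  ... | no j≢i   = no λ { (o-x .i) → j≢i refl }
  occurs? y     (var i)         = no λ ()
  occurs? (x j) yvar            = no λ ()
  occurs? y     yvar            = yes o-y
  occurs? v     (cst c)         = no λ ()
  occurs? v     (ext h l p q t) = map′ o-ext (λ { (o-ext o) → o }) (occurs? v t)
  occurs? v     (cat t u)       = map′ [ o-catˡ , o-catʳ ]
    (λ { (o-catˡ o) → inj₁ o ; (o-catʳ o) → inj₂ o }) (occurs? v t ⊎-dec occurs? v u)
  occurs? v     (op1 f t)       = map′ o-op1 (λ { (o-op1 o) → o }) (occurs? v t)
  occurs? v     (op2 f t u)     = map′ [ o-op2ˡ , o-op2ʳ ]
    (λ { (o-op2ˡ o) → inj₁ o ; (o-op2ʳ o) → inj₂ o }) (occurs? v t ⊎-dec occurs? v u)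

  occursL? : (v : Var V) (l : Lit V) → Dec (OccL V v l)
  occursL? v (t ≐ u) = occurs? v t ⊎-dec occurs? v u
  occursL? v (t ≉ u) = occurs? v t ⊎-dec occurs? v u

  evaluable? : ∀ {w} (t : Tm V w) → Dec (Evaluable V t)
  evaluable? t with occurs? y t
  ... | yes o = no (λ e → e o)
  ... | no e  = yes e

  evalE≡eval : (M : Asg V) → ∀ {w} (t : Tm V w) (p : Evaluable V t) (yv : BV wy) →
               evalE V M t p ≡ eval V M yv t
  evalE≡eval M (var i)         p yv = refl
  evalE≡eval M yvar            p yv = ⊥-elim (p o-y)
  evalE≡eval M (cst c)         p yv = refl
  evalE≡eval M (ext h l _ _ t) p yv = cong (extractBV h l) (evalE≡eval M t _ yv)
  evalE≡eval M (cat t u)       p yv = cong₂ concatBV (evalE≡eval M t _ yv) (evalE≡eval M u _ yv)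
  evalE≡eval M (op1 f t)       p yv = cong f (evalE≡eval M t _ yv)
  evalE≡eval M (op2 f t u)     p yv = cong₂ f (evalE≡eval M t _ yv) (evalE≡eval M u _ yv)

  ⟪⟫-injective : ∀ {w} {a b : Tm V w} → ⟪_⟫ V a ≡ ⟪_⟫ V b → a ≡ b
  ⟪⟫-injective refl = refl

  value : Asg V → BV wy → ATm V → Σ ℕ BV
  value ρ yv (w , t) = w , eval V ρ yv t

  private
    bounds : ATm V → Maybe (ℕ × ℕ)
    bounds (_ , ext h l _ _ yvar) = just (h , l)
    bounds _                      = nothing

    slice≢ : ∀ {h l} {A : Set} → _≡_ {A = Maybe (ℕ × ℕ)} (just (h , l)) nothing → A
    slice≢ ()

  isSliceTm? : (s : Slice V) → ∀ {w} (t : Tm V w) → Dec (⟪_⟫ V (sliceTm V s) ≡ ⟪_⟫ V t)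
  isSliceTm? (h , l , _ , _) (ext h′ l′ _ _ yvar) with h ℕ.≟ h′ | l ℕ.≟ l′
  ... | yes refl | yes refl = yes refl
  ... | no h≢h′  | _        = no λ e → h≢h′ (cong proj₁ (just-injective (cong bounds e)))
  ... | yes _    | no l≢l′  = no λ e → l≢l′ (cong proj₂ (just-injective (cong bounds e)))
  isSliceTm? (_ , _ , _ , _) (ext _ _ _ _ (var _))       = no λ e → slice≢ (cong bounds e)
  isSliceTm? (_ , _ , _ , _) (ext _ _ _ _ (cst _))       = no λ e → slice≢ (cong bounds e)
  isSliceTm? (_ , _ , _ , _) (ext _ _ _ _ (ext _ _ _ _ _)) = no λ e → slice≢ (cong bounds e)
  isSliceTm? (_ , _ , _ , _) (ext _ _ _ _ (cat _ _))     = no λ e → slice≢ (cong bounds e)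
  isSliceTm? (_ , _ , _ , _) (ext _ _ _ _ (op1 _ _))     = no λ e → slice≢ (cong bounds e)
  isSliceTm? (_ , _ , _ , _) (ext _ _ _ _ (op2 _ _ _))   = no λ e → slice≢ (cong bounds e)
  isSliceTm? (_ , _ , _ , _) (var _)                     = no λ e → slice≢ (cong bounds e)
  isSliceTm? (_ , _ , _ , _) yvar                        = no λ e → slice≢ (cong bounds e)
  isSliceTm? (_ , _ , _ , _) (cst _)                     = no λ e → slice≢ (cong bounds e)
  isSliceTm? (_ , _ , _ , _) (cat _ _)                   = no λ e → slice≢ (cong bounds e)
  isSliceTm? (_ , _ , _ , _) (op1 _ _)                   = no λ e → slice≢ (cong bounds e)
  isSliceTm? (_ , _ , _ , _) (op2 _ _ _)                 = no λ e → slice≢ (cong bounds e)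

  isSlice? : (Sl : List (Slice V)) → ∀ {w} (t : Tm V w) → Dec (IsSlice V Sl t)
  isSlice? []       t = no λ { (_ , () , _) }
  isSlice? (s ∷ Sl) t with isSliceTm? s t | isSlice? Sl t
  ... | yes e | _                  = yes (s , here refl , e)
  ... | no _  | yes (s′ , s′∈ , e) = yes (s′ , there s′∈ , e)
  ... | no ¬e | no ¬rest           = no λ
    { (_ , here refl , e) → ¬e e ; (s′ , there s′∈ , e) → ¬rest (s′ , s′∈ , e) }

  slice-not-evaluable : ∀ {Sl w} {t : Tm V w} → IsSlice V Sl t → ¬ Evaluable V t
  slice-not-evaluable (s , _ , e) ev = ev (subst OccY e (o-ext o-y))
    where OccY : ATm V → Set
          OccY (_ , t) = Occ V y t

-- Values prescribed on pairwise disjoint slices are realised by one value of y.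
-- In the MSB-first vector, slice y[h:l] occupies positions wy∸h … wy∸l−1.
module Assemble (V : Vars) where
  open Vars V

  Covers : Slice V → ℕ → Set
  Covers (h , l , _ , _) q = wy ∸ h ≤ q × q < wy ∸ l

  covers? : ∀ s q → Dec (Covers s q)
  covers? (h , l , _ , _) q = (wy ∸ h ≤? q) ×-dec (q <? wy ∸ l)

  disjoint-covers : ∀ (s s′ : Slice V) {q} → proj₁ s ≤ proj₁ (proj₂ s′) →
                    Covers s q → ¬ Covers s′ q
  disjoint-covers (h , _ , _ , _) (_ , l′ , _ , _) h≤l′ (from , _) (_ , below) =
    ℕₚ.<-irrefl refl (ℕₚ.<-≤-trans below (ℕₚ.≤-trans (ℕₚ.∸-monoʳ-≤ wy h≤l′) from))

  unique-cover : ∀ {Sl} → Disjoint V Sl → ∀ {s s′ q} → s ∈ Sl → s′ ∈ Sl →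
                 Covers s q → Covers s′ q → s′ ≡ s
  unique-cover {Sl} dj {s} {s′} s∈ s′∈ cov cov′ with Any.index s∈ Fin.≟ Any.index s′∈
  ... | yes same = trans (Anyₚ.lookup-index s′∈)
                     (trans (cong (lookup Sl) (sym same)) (sym (Anyₚ.lookup-index s∈)))
  ... | no differ with dj (Any.index s∈) (Any.index s′∈) differ
  ... | inj₁ apart = ⊥-elim (disjoint-covers s s′
          (subst₂ (λ a b → proj₁ a ≤ proj₁ (proj₂ b))
            (sym (Anyₚ.lookup-index s∈)) (sym (Anyₚ.lookup-index s′∈)) apart) cov cov′)
  ... | inj₂ apart = ⊥-elim (disjoint-covers s′ s
          (subst₂ (λ a b → proj₁ a ≤ proj₁ (proj₂ b))
            (sym (Anyₚ.lookup-index s′∈)) (sym (Anyₚ.lookup-index s∈)) apart) cov′ cov)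

  atPos-tabulate : ∀ {n} (f : ℕ → Bool) q → q < n → atPos (tabulate {n = n} (λ i → f (toℕ i))) q ≡ f q
  atPos-tabulate {suc n} f zero    _         = refl
  atPos-tabulate {suc n} f (suc q) (s≤s q<n) = atPos-tabulate {n} (λ j → f (suc j)) q q<n

  atPos-lookup : ∀ {n} (v : BV n) (i : Fin n) → atPos v (toℕ i) ≡ Vec.lookup v i
  atPos-lookup (b ∷ v) Fin.zero    = refl
  atPos-lookup (b ∷ v) (Fin.suc i) = atPos-lookup v i

  module _ (val : (s : Slice V) → BV (proj₁ s ∸ proj₁ (proj₂ s))) where

    bitAt : List (Slice V) → ℕ → Bool
    bitAt []       q = false
    bitAt (s ∷ Sl) q with covers? s q
    ... | yes _ = atPos (val s) (q ∸ (wy ∸ proj₁ s))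
    ... | no _  = bitAt Sl q

    bitAt-unique : ∀ Sl {s q} → s ∈ Sl → Covers s q → (∀ {s′} → s′ ∈ Sl → Covers s′ q → s′ ≡ s) →
                   bitAt Sl q ≡ atPos (val s) (q ∸ (wy ∸ proj₁ s))
    bitAt-unique (s₀ ∷ Sl) {s} {q} s∈ cov only with covers? s₀ q
    ... | yes cov₀ = cong (λ z → atPos (val z) (q ∸ (wy ∸ proj₁ z))) (only (here refl) cov₀)
    bitAt-unique (s₀ ∷ Sl) (here refl)  cov only | no ¬cov₀ = ⊥-elim (¬cov₀ cov)
    bitAt-unique (s₀ ∷ Sl) (there s∈)   cov only | no _     =
      bitAt-unique Sl s∈ cov (λ s′∈ cov′ → only (there s′∈) cov′)

  assemble : (Sl : List (Slice V)) → Disjoint V Sl →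
             (val : (s : Slice V) → BV (proj₁ s ∸ proj₁ (proj₂ s))) →
             Σ (BV wy) λ yv → ∀ ρ s → s ∈ Sl → eval V ρ yv (sliceTm V s) ≡ val s
  assemble Sl dj val = yv , onSlice
    where
      yv : BV wy
      yv = tabulate (λ i → bitAt val Sl (toℕ i))

      onSlice : ∀ ρ s → s ∈ Sl → eval V ρ yv (sliceTm V s) ≡ val s
      onSlice ρ s@(h , l , l<h , h≤wy) s∈ =
        trans (Vecₚ.tabulate-cong bit) (Vecₚ.tabulate∘lookup (val s))
        where
          bit : ∀ (i : Fin (h ∸ l)) → atPos yv ((wy ∸ h) + toℕ i) ≡ Vec.lookup (val s) i
          bit i = begin
            atPos yv q                    ≡⟨ atPos-tabulate (bitAt val Sl) q q<wy ⟩
            bitAt val Sl q                ≡⟨ bitAt-unique val Sl s∈ cov only ⟩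
            atPos (val s) (q ∸ (wy ∸ h))  ≡⟨ cong (atPos (val s)) (ℕₚ.m+n∸m≡n (wy ∸ h) (toℕ i)) ⟩
            atPos (val s) (toℕ i)         ≡⟨ atPos-lookup (val s) i ⟩
            Vec.lookup (val s) i          ∎
            where
              q : ℕ
              q = (wy ∸ h) + toℕ i
              width : (wy ∸ h) + (h ∸ l) ≡ wy ∸ l
              width = trans (sym (ℕₚ.+-∸-assoc (wy ∸ h) (ℕₚ.<⇒≤ l<h)))
                            (cong (_∸ l) (ℕₚ.m∸n+n≡m h≤wy))
              cov : Covers s q
              cov = ℕₚ.m≤m+n (wy ∸ h) (toℕ i)
                  , subst (q <_) width (ℕₚ.+-monoʳ-< (wy ∸ h) (Finₚ.toℕ<n i))
              only : ∀ {s′} → s′ ∈ Sl → Covers s′ q → s′ ≡ s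
              only s′∈ cov′ = unique-cover dj s∈ s′∈ cov cov′
              q<wy : q < wy
              q<wy = ℕₚ.<-≤-trans (proj₂ cov) (ℕₚ.m∸n≤m wy l)

module AlgorithmA (V : Vars) (M : Asg V) (E D : List (Eqn V)) (Sl : List (Slice V)) where
  open Vars V
  open Terms V

  Side : ∀ {w} → Tm V w → Set
  Side = SideOK V E D Sl

  SideA : ATm V → Set
  SideA (_ , t) = Side t

  EvaluableA : ATm V → Set
  EvaluableA (_ , t) = Evaluable V t

  occursF? : ∀ i → Dec (OccF V E D i)
  occursF? i = Any.any? (λ e → occursL? (x i) (eqLit V e)) E
        ⊎-dec Any.any? (λ d → occursL? (x i) (neqLit V d)) D

  side-stable : ∀ {w} (t : Tm V w) → ¬ ¬ Side t → Side t
  side-stable t ¬¬side with evaluable? t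
  ... | no ¬ev = inj₂ (decidable-stable (isSlice? Sl t)
          (λ ¬slice → ¬¬side λ { (inj₁ (ev , _)) → ¬ev ev ; (inj₂ slice) → ¬slice slice }))
  ... | yes ev = inj₁ (ev , λ i o → decidable-stable (occursF? i)
          (λ ¬occ → ¬¬side λ { (inj₁ (_ , inF)) → ¬occ (inF i o)
                             ; (inj₂ slice) → slice-not-evaluable slice ev }))

  record Invariant (R : Rep V) : Set where
    field
      rep-evaluable : ∀ {w} (s : Tm V w) → Evaluable V s → Evaluable V (R s)
      rep-value     : ∀ {w} (s : Tm V w) → Evaluable V s → ∀ yv → eval V M yv (R s) ≡ eval V M yv s
      rep-side      : ∀ {w} (s : Tm V w) → Side s → Side (R s)
  open Invariant

  Sound : Rep V → Asg V → BV wy → Set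
  Sound R ρ yv = ∀ {w} (s : Tm V w) → eval V ρ yv (R s) ≡ eval V ρ yv s

  id-invariant : Invariant (idRep V)
  id-invariant = record
    { rep-evaluable = λ _ ev → ev ; rep-value = λ _ _ _ → refl ; rep-side = λ _ side → side }

  id-sound : ∀ ρ yv → Sound (idRep V) ρ yv
  id-sound ρ yv s = refl

  module MergeStep {R R′ : Rep V} {w} {t₁ t₂ : Tm V w} (c : Tm V w)
    (noClash : ¬ Clash V M (R t₁) (R t₂))
    (c-rep : c ≡ R t₁ ⊎ c ≡ R t₂)
    (c-ev : Evaluable V (R t₁) ⊎ Evaluable V (R t₂) → Evaluable V c)
    (merged : Merge V R (R t₁) (R t₂) c R′) where

    Joined : ∀ {w′} → Tm V w′ → Set
    Joined s = ⟪_⟫ V (R s) ≡ ⟪_⟫ V (R t₁) ⊎ ⟪_⟫ V (R s) ≡ ⟪_⟫ V (R t₂)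

    Outcome : ∀ {w′} → Tm V w′ → Set
    Outcome s = (Joined s × ⟪_⟫ V (R′ s) ≡ ⟪_⟫ V c) ⊎ (¬ Joined s × R′ s ≡ R s)

    after-merge : ∀ {w′} (s : Tm V w′) → ¬ ¬ Outcome s
    after-merge s = do
      in₁ ← ¬¬-excluded-middle
      in₂ ← ¬¬-excluded-middle
      pure (classify in₁ in₂)
      where
        classify : Dec (⟪_⟫ V (R s) ≡ ⟪_⟫ V (R t₁)) → Dec (⟪_⟫ V (R s) ≡ ⟪_⟫ V (R t₂)) →
                   Outcome s
        classify (yes e₁) _        = inj₁ (inj₁ e₁ , proj₁ (merged s) (inj₁ e₁))
        classify (no _)   (yes e₂) = inj₁ (inj₂ e₂ , proj₁ (merged s) (inj₂ e₂))
        classify (no n₁)  (no n₂)  = inj₂ ([ n₁ , n₂ ] , proj₂ (merged s) n₁ n₂)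

    merged-identified : R′ t₁ ≡ R′ t₂
    merged-identified = ⟪⟫-injective (trans (proj₁ (merged t₁) (inj₁ refl))
                                            (sym (proj₁ (merged t₂) (inj₂ refl))))

    merge-respects : ∀ {w′} (s s′ : Tm V w′) → R s ≡ R s′ → ¬ ¬ (R′ s ≡ R′ s′)
    merge-respects s s′ e = ¬¬-map same (after-merge s)
      where
        transport : Joined s → Joined s′
        transport = [ (λ j → inj₁ (trans (cong (⟪_⟫ V) (sym e)) j))
                    , (λ j → inj₂ (trans (cong (⟪_⟫ V) (sym e)) j)) ]
        same : Outcome s → R′ s ≡ R′ s′
        same (inj₁ (j , e₁)) = ⟪⟫-injective (trans e₁ (sym (proj₁ (merged s′) (transport j))))
        same (inj₂ (¬j , e₁)) = trans e₁ (trans e (sym (proj₂ (merged s′)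
          (λ j → ¬j (inj₁ (trans (cong (⟪_⟫ V) e) j)))
          (λ j → ¬j (inj₂ (trans (cong (⟪_⟫ V) e) j))))))

    module _ (ρ : Asg V) (yv : BV wy) (holds : eval V ρ yv t₁ ≡ eval V ρ yv t₂)
             (sound : Sound R ρ yv) where

      joined-value : ∀ {w′} {s : Tm V w′} → Joined s → value ρ yv (⟪_⟫ V (R s)) ≡ (w , eval V ρ yv t₁)
      joined-value (inj₁ e) = trans (cong (value ρ yv) e) (cong (w ,_) (sound t₁))
      joined-value (inj₂ e) = trans (cong (value ρ yv) e) (cong (w ,_) (trans (sound t₂) (sym holds)))

      c-value : eval V ρ yv c ≡ eval V ρ yv t₁
      c-value = [ (λ c≡ → trans (cong (eval V ρ yv) c≡) (sound t₁))
                , (λ c≡ → trans (cong (eval V ρ yv) c≡) (trans (sound t₂) (sym holds))) ] c-rep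

      merge-sound : Sound R′ ρ yv
      merge-sound s = bv-stable (¬¬-map via-merge (after-merge s))
        where
          via-merge : Outcome s → eval V ρ yv (R′ s) ≡ eval V ρ yv s
          via-merge (inj₁ (j , e)) = pair-injective (trans (cong (value ρ yv) e)
            (trans (cong (w ,_) c-value) (trans (sym (joined-value j)) (cong (_ ,_) (sound s)))))
          via-merge (inj₂ (_ , e)) = trans (cong (eval V ρ yv) e) (sound s)

    module _ (inv : Invariant R) (sides : EqnOK V E D Sl (w , t₁ , t₂)) where

      same-M-value : Evaluable V (R t₁) → Evaluable V (R t₂) → ∀ yv →
                     eval V M yv (R t₁) ≡ eval V M yv (R t₂)
      same-M-value p₁ p₂ yv = bv-stable λ ne → noClash (p₁ , p₂ , λ e → ne
        (trans (sym (evalE≡eval M (R t₁) p₁ yv)) (trans e (evalE≡eval M (R t₂) p₂ yv))))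

      c-evaluable : ∀ {w′} {s : Tm V w′} → Joined s → Evaluable V (R s) → Evaluable V c
      c-evaluable (inj₁ e) ev = c-ev (inj₁ (subst EvaluableA e ev))
      c-evaluable (inj₂ e) ev = c-ev (inj₂ (subst EvaluableA e ev))

      c-value₁ : Evaluable V (R t₁) → ∀ yv → eval V M yv c ≡ eval V M yv (R t₁)
      c-value₁ p₁ yv =
        [ cong (eval V M yv)
        , (λ c≡ → trans (cong (eval V M yv) c≡)
                    (sym (same-M-value p₁ (subst (Evaluable V) c≡ (c-ev (inj₁ p₁))) yv))) ] c-rep

      c-value₂ : Evaluable V (R t₂) → ∀ yv → eval V M yv c ≡ eval V M yv (R t₂)
      c-value₂ p₂ yv =
        [ (λ c≡ → trans (cong (eval V M yv) c≡)
                    (same-M-value (subst (Evaluable V) c≡ (c-ev (inj₂ p₂))) p₂ yv))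
        , cong (eval V M yv) ] c-rep

      c-M-value : ∀ {w′} {s : Tm V w′} → Joined s → Evaluable V (R s) → ∀ yv →
                  value M yv (⟪_⟫ V c) ≡ value M yv (⟪_⟫ V (R s))
      c-M-value (inj₁ e) ev yv =
        trans (cong (w ,_) (c-value₁ (subst EvaluableA e ev) yv)) (sym (cong (value M yv) e))
      c-M-value (inj₂ e) ev yv =
        trans (cong (w ,_) (c-value₂ (subst EvaluableA e ev) yv)) (sym (cong (value M yv) e))

      c-side : Side c
      c-side = [ (λ c≡ → subst Side (sym c≡) (rep-side inv t₁ (proj₁ sides)))
               , (λ c≡ → subst Side (sym c≡) (rep-side inv t₂ (proj₂ sides))) ] c-rep

      merge-invariant : Invariant R′
      merge-invariant = record { rep-evaluable = evaluable′ ; rep-value = value′ ; rep-side = side′ }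
        where
          evaluable′ : ∀ {w′} (s : Tm V w′) → Evaluable V s → Evaluable V (R′ s)
          evaluable′ s ev o = after-merge s λ
            { (inj₁ (j , e)) → subst EvaluableA (sym e) (c-evaluable j (rep-evaluable inv s ev)) o
            ; (inj₂ (_ , e)) → subst (Evaluable V) (sym e) (rep-evaluable inv s ev) o }

          value′ : ∀ {w′} (s : Tm V w′) → Evaluable V s → ∀ yv → eval V M yv (R′ s) ≡ eval V M yv s
          value′ s ev yv = bv-stable (¬¬-map via-merge (after-merge s))
            where
              via-merge : Outcome s → eval V M yv (R′ s) ≡ eval V M yv s
              via-merge (inj₁ (j , e)) = pair-injective (trans (cong (value M yv) e)
                (trans (c-M-value j (rep-evaluable inv s ev) yv) (cong (_ ,_) (rep-value inv s ev yv))))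
              via-merge (inj₂ (_ , e)) = trans (cong (eval V M yv) e) (rep-value inv s ev yv)

          side′ : ∀ {w′} (s : Tm V w′) → Side s → Side (R′ s)
          side′ s side = side-stable (R′ s) (¬¬-map via-merge (after-merge s))
            where
              via-merge : Outcome s → Side (R′ s)
              via-merge (inj₁ (_ , e)) = subst SideA (sym e) c-side
              via-merge (inj₂ (_ , e)) = subst Side (sym e) (rep-side inv s side)

  open MergeStep using (merged-identified; merge-respects; merge-sound; merge-invariant)

  run-invariant : ∀ {R : Rep V} {es} {G : Rep V} → RunA V M R es (graph G) →
                  All (EqnOK V E D Sl) es → Invariant R → Invariant G
  run-invariant done                        _          inv = inv
  run-invariant (merge c nc cr ce mg run) (ok ∷ oks) inv =
    run-invariant run oks (merge-invariant c nc cr ce mg inv ok)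

  run-sound : ∀ {R : Rep V} {es} {G : Rep V} → RunA V M R es (graph G) → ∀ ρ yv →
              All (HoldsEq V ρ yv) es → Sound R ρ yv → Sound G ρ yv
  run-sound done                      ρ yv _        sound = sound
  run-sound (merge c nc cr ce mg run) ρ yv (h ∷ hs) sound =
    run-sound run ρ yv hs (merge-sound c nc cr ce mg ρ yv h sound)

  run-respects : ∀ {R : Rep V} {es} {G : Rep V} → RunA V M R es (graph G) →
                 ∀ {w} (s s′ : Tm V w) → R s ≡ R s′ → ¬ ¬ (G s ≡ G s′)
  run-respects done                      s s′ e = pure e
  run-respects (merge c nc cr ce mg run) s s′ e =
    merge-respects c nc cr ce mg s s′ e >>= run-respects run s s′

  run-identifies : ∀ {R : Rep V} {es} {G : Rep V} → RunA V M R es (graph G) →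
                   All (λ e → ¬ ¬ (G (lhs V e) ≡ G (rhs V e))) es
  run-identifies done = []
  run-identifies (merge {t1 = t₁} {t₂} c nc cr ce mg run) =
    run-respects run t₁ t₂ (merged-identified c nc cr ce mg) ∷ run-identifies run

  Entailed : Rep V → List (Eqn V) → ∀ {w} → Tm V w → Tm V w → Set
  Entailed R es a b = ∀ ρ yv → All (HoldsEq V ρ yv) es → Sound R ρ yv → eval V ρ yv a ≡ eval V ρ yv b

  run-conflict : ∀ {R : Rep V} {es w} {a b : Tm V w} → RunA V M R es (conflict a b) →
                 All (EqnOK V E D Sl) es → Invariant R →
                 Clash V M a b × Side a × Side b × Entailed R es a b
  run-conflict (stop {t1 = t₁} {t₂} clash) (ok ∷ _) inv =
      clash , rep-side inv t₁ (proj₁ ok) , rep-side inv t₂ (proj₂ ok)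
    , λ { ρ yv (h ∷ _) sound → trans (sound t₁) (trans h (sym (sound t₂))) }
  run-conflict (merge c nc cr ce mg run) (ok ∷ oks) inv
    with run-conflict run oks (merge-invariant c nc cr ce mg inv ok)
  ... | clash , side-a , side-b , entailed = clash , side-a , side-b ,
    λ { ρ yv (h ∷ hs) sound → entailed ρ yv hs (merge-sound c nc cr ce mg ρ yv h sound) }

module ConflictCoreFacts (V : Vars) (M : Asg V) (E D : List (Eqn V)) (core : ConflictCore V M E D) where
  open Vars V

  unsatisfiable : ¬ Σ (BV wy) λ yv → HoldsF V E D M yv
  unsatisfiable = proj₁ (proj₂ (proj₂ core))

  -- Minimality: no disequality of D is implied at M by the equalities E.
  -- Dropping d₀ from the core leaves a satisfiable set, whose model would
  -- otherwise satisfy d₀ and hence the whole core.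
  disequality-needed : ∀ {d₀} → d₀ ∈ D → ¬ (∀ yv → All (HoldsEq V M yv) E → HoldsNeq V M yv d₀)
  disequality-needed {d₀} d₀∈ implied = decisions refute
    where
      lits : List (Lit V)
      lits = litsF V E D

      L₀ : Lit V
      L₀ = neqLit V d₀

      eq∈ : ∀ {e} → e ∈ E → eqLit V e ∈ lits
      eq∈ e∈ = ∈-++⁺ˡ (∈-map⁺ (eqLit V) e∈)

      neq∈ : ∀ {d} → d ∈ D → neqLit V d ∈ lits
      neq∈ d∈ = ∈-++⁺ʳ (map (eqLit V) E) (∈-map⁺ (neqLit V) d∈)

      decisions : ¬ ¬ All (λ l → Dec (l ≡ L₀)) lits
      decisions = All.sequenceM 0ℓ ¬¬-Monad (All.universal (λ _ → ¬¬-excluded-middle) lits)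

      refute : All (λ l → Dec (l ≡ L₀)) lits → ⊥
      refute ds = unsatisfiable (yv , holdsE , holdsD)
        where
          minimal : Σ (BV wy) λ yv → All (holdsL V M yv) (without L₀ lits ds)
          minimal = proj₂ (proj₂ (proj₂ core)) (without L₀ lits ds)
                      (λ l∈ → proj₁ (without-⊆ L₀ lits ds l∈))
                      (L₀ , neq∈ d₀∈ , λ L₀∈ → proj₂ (without-⊆ L₀ lits ds L₀∈) refl)

          yv : BV wy
          yv = proj₁ minimal

          others : ∀ {l} → l ∈ lits → l ≢ L₀ → holdsL V M yv l
          others l∈ l≢L₀ = All.lookup (proj₂ minimal) (without-⊇ L₀ lits ds l∈ l≢L₀)

          holdsE : All (HoldsEq V M yv) E
          holdsE = All.tabulate λ e∈ → others (eq∈ e∈) (λ ())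

          holdsD : All (HoldsNeq V M yv) D
          holdsD = All.tabulate λ {d} d∈ → case (All.lookup ds (neq∈ d∈)) (others (neq∈ d∈))
            where
              case : ∀ {d} → Dec (neqLit V d ≡ L₀) → (neqLit V d ≢ L₀ → HoldsNeq V M yv d) →
                     HoldsNeq V M yv d
              case (yes d≡d₀) _    = subst (holdsL V M yv) (sym d≡d₀) (implied yv holdsE)
              case (no d≢d₀) other = other d≢d₀

module Main (V : Vars) (M : Asg V) (E D : List (Eqn V)) (core : ConflictCore V M E D)
            (Sl : List (Slice V)) (Ê : List (Eqn V)) (D̂ : List (List (Eqn V)))
            (sliced : SlicedForms V E D Sl Ê D̂) where
  open Vars V
  open Terms V
  open AlgorithmA V M E D Sl
  open Invariant
  open ConflictCoreFacts V M E D core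
  open Assemble V using (assemble)

  disjoint : Disjoint V Sl
  disjoint = proj₁ sliced

  Ê-sides : All (EqnOK V E D Sl) Ê
  Ê-sides = proj₁ (proj₂ sliced)

  D̂-sides : All (All (EqnOK V E D Sl)) D̂
  D̂-sides = proj₁ (proj₂ (proj₂ sliced))

  E⇔Ê : ∀ ρ yv → All (HoldsEq V ρ yv) E ⇔ All (HoldsEq V ρ yv) Ê
  E⇔Ê = proj₁ (proj₂ (proj₂ (proj₂ sliced)))

  Stands : Eqn V → List (Eqn V) → Set
  Stands d C = ∀ ρ yv → HoldsNeq V ρ yv d ⇔ Any (HoldsNeq V ρ yv) C

  D∼D̂ : Pointwise Stands D D̂
  D∼D̂ = proj₂ (proj₂ (proj₂ (proj₂ sliced)))

  side-vars : ∀ {w} {t : Tm V w} → Evaluable V t → Side t → ∀ i → Occ V (x i) t → OccF V E D i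
  side-vars _  (inj₁ (_ , inF)) i o = inF i o
  side-vars ev (inj₂ slice)     i o = ⊥-elim (slice-not-evaluable slice ev)

  side-slice : ∀ {w} {t : Tm V w} → ¬ Evaluable V t → Side t → IsSlice V Sl t
  side-slice ¬ev (inj₁ (ev , _)) = ⊥-elim (¬ev ev)
  side-slice _   (inj₂ slice)    = slice

  Admissible : Lit V → Set
  Admissible l = ¬ OccL V y l × (∀ i → OccL V (x i) l → OccF V E D i)

  admissible : ∀ {w} {a b : Tm V w} → Evaluable V a → Evaluable V b → Side a → Side b →
               Admissible (a ≐ b) × Admissible (a ≉ b)
  admissible {a = a} {b} p q side-a side-b = sides , sides
    where
      sides : ¬ (Occ V y a ⊎ Occ V y b) × (∀ i → Occ V (x i) a ⊎ Occ V (x i) b → OccF V E D i)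
      sides = [ p , q ] , λ i → [ side-vars p side-a i , side-vars q side-b i ]

  clash-false : ∀ {w} {a b : Tm V w} → Clash V M a b → ∀ yv → ¬ holdsL V M yv (a ≐ b)
  clash-false (p , q , a≢b) yv h =
    a≢b (trans (evalE≡eval M _ p yv) (trans h (sym (evalE≡eval M _ q yv))))

  agree-false : ∀ {w} {a b : Tm V w} (p : Evaluable V a) (q : Evaluable V b) →
                evalE V M a p ≡ evalE V M b q → ∀ yv → ¬ holdsL V M yv (a ≉ b)
  agree-false p q a≡b yv h = h (trans (sym (evalE≡eval M _ p yv)) (trans a≡b (evalE≡eval M _ q yv)))

  conflict-interpolant : ∀ {w} (a b : Tm V w) → RunA V M (idRep V) Ê (conflict a b) →
                         Interpolant V E D M (λ l → l ≡ (a ≐ b))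
  conflict-interpolant a b run with run-conflict run Ê-sides id-invariant
  ... | clash@(p , q , _) , side-a , side-b , entailed =
        (λ ρ yv hF → (a ≐ b) , refl ,
                     entailed ρ yv (Equivalence.to (E⇔Ê ρ yv) (proj₁ hF)) (id-sound ρ yv))
      , (λ { _ refl → proj₁ (admissible p q side-a side-b) })
      , (λ { yv (_ , refl , h) → clash-false clash yv h })

  module WithGraph (G : Rep V) (run : RunA V M (idRep V) Ê (graph G)) where

    graph-invariant : Invariant G
    graph-invariant = run-invariant run Ê-sides id-invariant

    graph-sound : ∀ ρ yv → All (HoldsEq V ρ yv) E → Sound G ρ yv
    graph-sound ρ yv hE = run-sound run ρ yv (Equivalence.to (E⇔Ê ρ yv) hE) (id-sound ρ yv)

    rep-sides : ∀ {C} → C ∈ D̂ → ∀ {w} {t₁ t₂ : Tm V w} → (w , t₁ , t₂) ∈ C → Side (G t₁) × Side (G t₂)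
    rep-sides C∈ d∈ = let ok = All.lookup (All.lookup D̂-sides C∈) d∈ in
      rep-side graph-invariant _ (proj₁ ok) , rep-side graph-invariant _ (proj₂ ok)

    true-disequality : ∀ ρ yv → HoldsF V E D ρ yv → ∀ {C} → C ∈ D̂ →
                       Σ (Eqn V) λ d → d ∈ C × HoldsNeq V ρ yv d
    true-disequality ρ yv hF C∈ =
      let _ , d₀∈ , stands = pointwise-partner D∼D̂ C∈ in
      find (Equivalence.to (stands ρ yv) (All.lookup (proj₂ hF) d₀∈))

    separated : ∀ ρ yv → All (HoldsEq V ρ yv) E → ∀ {w} {t₁ t₂ : Tm V w} →
                HoldsNeq V ρ yv (w , t₁ , t₂) → eval V ρ yv (G t₁) ≢ eval V ρ yv (G t₂)
    separated ρ yv hE {t₁ = t₁} {t₂} t₁≢t₂ e = t₁≢t₂ (trans (sym (sound t₁)) (trans e (sound t₂)))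
      where sound : Sound G ρ yv
            sound = graph-sound ρ yv hE

    -- By minimality of the core, the representatives of a disequality of D̂
    -- never clash at M: otherwise E would imply the disequality of D behind the clause.
    no-clash : ∀ {C} → C ∈ D̂ → ∀ {w} {t₁ t₂ : Tm V w} → (w , t₁ , t₂) ∈ C → ¬ Clash V M (G t₁) (G t₂)
    no-clash C∈ {t₁ = t₁} {t₂} d∈ clash with pointwise-partner D∼D̂ C∈
    ... | _ , d₀∈ , stands = disequality-needed d₀∈ λ yv hE →
      Equivalence.from (stands M yv) (lose d∈ λ e →
        clash-false clash yv (trans (graph-sound M yv hE t₁) (trans e (sym (graph-sound M yv hE t₂)))))

    -- The classification of Algorithm B; the case of representatives that are
    -- evaluable with distinct M-values does not occur, by no-clash.
    classify : ∀ {C} → C ∈ D̂ → ∀ {w} {t₁ t₂ : Tm V w} → (w , t₁ , t₂) ∈ C → G t₁ ≢ G t₂ →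
               InCM V M Sl G (w , t₁ , t₂) ⊎ InCint V M Sl G (w , t₁ , t₂)
                 ⊎ InCfree V M Sl G (w , t₁ , t₂)
    classify C∈ {t₁ = t₁} {t₂} d∈ distinct with evaluable? (G t₁) | evaluable? (G t₂) | rep-sides C∈ d∈
    ... | yes p₁ | yes p₂ | _ =
      inj₁ (distinct , p₁ , p₂ , bv-stable λ ne → no-clash C∈ d∈ (p₁ , p₂ , ne))
    ... | yes p₁ | no ¬p₂ | _ , side₂ = inj₂ (inj₁ (distinct , inj₁ (p₁ , side-slice ¬p₂ side₂)))
    ... | no ¬p₁ | yes p₂ | side₁ , _ = inj₂ (inj₁ (distinct , inj₂ (side-slice ¬p₁ side₁ , p₂)))
    ... | no ¬p₁ | no ¬p₂ | side₁ , side₂ =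
      inj₂ (inj₂ (distinct , side-slice ¬p₁ side₁ , side-slice ¬p₂ side₂))

    crep-admissible : ∀ {C} → C ∈ D̂ → ∀ l → CrepM V M Sl G C l → Admissible l
    crep-admissible C∈ _ (_ , d∈ , (_ , p₁ , p₂ , _) , refl) =
      proj₂ (admissible p₁ p₂ (proj₁ (rep-sides C∈ d∈)) (proj₂ (rep-sides C∈ d∈)))

    crep-false : ∀ C yv → ¬ HoldsC V M yv (CrepM V M Sl G C)
    crep-false C yv (_ , (_ , _ , (_ , p₁ , p₂ , agree) , refl) , h) = agree-false p₁ p₂ agree yv h

    -- Claim (2): a clause without interface and free disequalities yields the
    -- interpolant C^rep_M, since its true disequality must lie in C_M.
    stop-interpolant : ∀ {C} → C ∈ D̂ → NoIF V M Sl G C → Interpolant V E D M (CrepM V M Sl G C)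
    stop-interpolant {C} C∈ noIF = entailed , crep-admissible C∈ , crep-false C
      where
        entailed : ∀ ρ yv → HoldsF V E D ρ yv → HoldsC V ρ yv (CrepM V M Sl G C)
        entailed ρ yv hF with true-disequality ρ yv hF C∈
        ... | (w , t₁ , t₂) , d∈ , h with separated ρ yv (proj₁ hF) h
        ... | sep with classify C∈ d∈ (λ e → sep (cong (eval V ρ yv) e))
        ... | inj₁ inCM          = (G t₁ ≉ G t₂) , (_ , d∈ , inCM , refl) , sep
        ... | inj₂ (inj₁ inCint)  = ⊥-elim (proj₁ (All.lookup noIF d∈) inCint)
        ... | inj₂ (inj₂ inCfree) = ⊥-elim (proj₂ (All.lookup noIF d∈) inCfree)

    S : ATm V → Set
    S = InS V M Sl G D̂

    Final : Clause V
    Final = FinalClause V M Sl G D̂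

    S-side : ∀ {w} {s : Tm V w} → S (⟪_⟫ V s) → Side s
    S-side (_ , C∈ , _ , d∈ , _ , inj₁ (e , _)) = subst SideA (sym e) (proj₁ (rep-sides C∈ d∈))
    S-side (_ , C∈ , _ , d∈ , _ , inj₂ (e , _)) = subst SideA (sym e) (proj₂ (rep-sides C∈ d∈))

    final-admissible : ∀ l → Final l → Admissible l
    final-admissible l (inj₁ (_ , C∈ , crep)) = crep-admissible C∈ l crep
    final-admissible _ (inj₂ (inj₁ (_ , _ , _ , i₁ , i₂ , (p₁ , p₂ , _) , refl))) =
      proj₁ (admissible p₁ p₂ (S-side i₁) (S-side i₂))
    final-admissible _ (inj₂ (inj₂ (_ , _ , _ , i₁ , i₂ , _ , (p₁ , p₂ , _) , refl))) =
      proj₂ (admissible p₁ p₂ (S-side i₁) (S-side i₂))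

    final-false : ∀ yv → ¬ HoldsC V M yv Final
    final-false yv (l , inj₁ (C , _ , crep) , h) = crep-false C yv (l , crep , h)
    final-false yv (_ , inj₂ (inj₁ (_ , _ , _ , _ , _ , clash , refl)) , h) = clash-false clash yv h
    final-false yv (_ , inj₂ (inj₂ (_ , _ , _ , _ , _ , _ , (p₁ , p₂ , agree) , refl)) , h) =
      agree-false p₁ p₂ agree yv h

    -- Claim (3), condition (i): the final clause holds in every model (ρ , yv)
    -- of F.  Either a literal of it is found true, or a countermodel at M arises.
    module FinalEntailed (ρ : Asg V) (yv : BV wy) (hF : HoldsF V E D ρ yv) where

      Entry : Set
      Entry = Σ ℕ λ w → Σ (Tm V w) λ e → Evaluable V e × S (⟪_⟫ V e)

      ρ-value M-value : Entry → Σ ℕ BV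
      ρ-value (w , e , _ , _) = w , eval V ρ yv e
      M-value (w , e , p , _) = w , evalE V M e p

      Recorded : List Entry → ∀ {w} → Tm V w → Set
      Recorded P {w} t =
        ¬ Evaluable V t ⊎ Σ (Evaluable V t) λ p → Σ (S (⟪_⟫ V t)) λ i → (w , t , p , i) ∈ P

      Handled : List Entry → List (Eqn V) → Set
      Handled P C = Σ ℕ λ w → Σ (Tm V w) λ t₁ → Σ (Tm V w) λ t₂ →
        (w , t₁ , t₂) ∈ C × HoldsNeq V ρ yv (w , t₁ , t₂) × Recorded P (G t₁) × Recorded P (G t₂)

      handled-mono : ∀ {P P′} → (∀ {e} → e ∈ P → e ∈ P′) → ∀ {C} → Handled P C → Handled P′ C
      handled-mono ⊆ (w , t₁ , t₂ , d∈ , h , r₁ , r₂) = w , t₁ , t₂ , d∈ , h , grow r₁ , grow r₂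
        where
          grow : ∀ {w} {t : Tm V w} → Recorded _ t → Recorded _ t
          grow (inj₁ ¬p)          = inj₁ ¬p
          grow (inj₂ (p , i , e∈)) = inj₂ (p , i , ⊆ e∈)

      Out : Set
      Out = HoldsC V ρ yv Final

      handle : ∀ {C} → C ∈ D̂ → Out ⊎ Σ (List Entry) λ P → Handled P C
      handle {C} C∈ with true-disequality ρ yv hF C∈
      ... | (w , t₁ , t₂) , d∈ , h with separated ρ yv (proj₁ hF) h
      ... | sep with classify C∈ d∈ (λ e → sep (cong (eval V ρ yv) e))
      ... | inj₁ inCM = inj₁ ((G t₁ ≉ G t₂) , inj₁ (C , C∈ , _ , d∈ , inCM , refl) , sep)
      ... | inj₂ (inj₁ inCint@(_ , inj₁ (p₁ , slice₂))) =
        inj₂ ((w , G t₁ , p₁ , i) ∷ [] ,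
              w , t₁ , t₂ , d∈ , h , inj₂ (p₁ , i , here refl) , inj₁ (slice-not-evaluable slice₂))
        where i : S (⟪_⟫ V (G t₁))
              i = C , C∈ , _ , d∈ , inCint , inj₁ (refl , p₁)
      ... | inj₂ (inj₁ inCint@(_ , inj₂ (slice₁ , p₂))) =
        inj₂ ((w , G t₂ , p₂ , i) ∷ [] ,
              w , t₁ , t₂ , d∈ , h , inj₁ (slice-not-evaluable slice₁) , inj₂ (p₂ , i , here refl))
        where i : S (⟪_⟫ V (G t₂))
              i = C , C∈ , _ , d∈ , inCint , inj₂ (refl , p₂)
      ... | inj₂ (inj₂ (_ , slice₁ , slice₂)) =
        inj₂ ([] , w , t₁ , t₂ , d∈ , h ,
                   inj₁ (slice-not-evaluable slice₁) , inj₁ (slice-not-evaluable slice₂))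

      handle-all : ∀ Cs → (∀ {C} → C ∈ Cs → C ∈ D̂) →
                   Out ⊎ Σ (List Entry) λ P → ∀ {C} → C ∈ Cs → Handled P C
      handle-all []       _   = inj₂ ([] , λ ())
      handle-all (C ∷ Cs) ⊆D̂ with handle (⊆D̂ (here refl)) | handle-all Cs (⊆D̂ ∘ there)
      ... | inj₁ out       | _              = inj₁ out
      ... | inj₂ _         | inj₁ out       = inj₁ out
      ... | inj₂ (P₁ , h₁) | inj₂ (P , hs) = inj₂ (P₁ ++ˡ P , λ
        { (here refl) → handled-mono ∈-++⁺ˡ h₁
        ; (there C∈)  → handled-mono (∈-++⁺ʳ P₁) (hs C∈) })

      Coherent : Entry → Entry → Set
      Coherent a b = ρ-value a ≡ ρ-value b ⇔ M-value a ≡ M-value b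

      compare : ∀ a b → Out ⊎ Coherent a b
      compare (w₁ , e₁ , p₁ , i₁) (w₂ , e₂ , p₂ , i₂) with w₁ ℕ.≟ w₂
      ... | no w₁≢w₂ = inj₂ (mk⇔ (λ e → ⊥-elim (w₁≢w₂ (cong proj₁ e)))
                                 (λ e → ⊥-elim (w₁≢w₂ (cong proj₁ e))))
      ... | yes refl with eval V ρ yv e₁ ≟ᵇᵛ eval V ρ yv e₂ | evalE V M e₁ p₁ ≟ᵇᵛ evalE V M e₂ p₂
      ... | yes ρ≡ | yes M≡ = inj₂ (mk⇔ (λ _ → cong (w₁ ,_) M≡) (λ _ → cong (w₁ ,_) ρ≡))
      ... | no ρ≢  | no M≢  = inj₂ (mk⇔ (λ e → ⊥-elim (ρ≢ (pair-injective e)))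
                                      (λ e → ⊥-elim (M≢ (pair-injective e))))
      ... | yes ρ≡ | no M≢  = inj₁ ((e₁ ≐ e₂) ,
            inj₂ (inj₁ (w₁ , e₁ , e₂ , i₁ , i₂ , (p₁ , p₂ , M≢) , refl)) , ρ≡)
      ... | no ρ≢  | yes M≡ = inj₁ ((e₁ ≉ e₂) ,
            inj₂ (inj₂ (w₁ , e₁ , e₂ , i₁ , i₂ , (λ e → ρ≢ (cong (eval V ρ yv) e)) ,
                        (p₁ , p₂ , M≡) , refl)) , ρ≢)

      coherent-all : ∀ P → Out ⊎ (∀ {a b} → a ∈ P → b ∈ P → Coherent a b)
      coherent-all P with search (λ a → search (compare a) P) P
      ... | inj₁ out = inj₁ out
      ... | inj₂ ok  = inj₂ λ a∈ b∈ → ok a∈ b∈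

      -- If every clause is handled and the entries are coherent, then relabelling
      -- the values of representatives by a permutation φ sending ρ-values of
      -- entries to M-values gives a value y′ of y with M , y′ ⊨ F.
      module Countermodel (P : List Entry) (handled : ∀ {C} → C ∈ D̂ → Handled P C)
                          (coherent : ∀ {a b} → a ∈ P → b ∈ P → Coherent a b) where
        open Permutation ℕ._≟_ BV _≟ᵇᵛ_

        pair : Entry → Pair
        pair (w , e , p , _) = w , eval V ρ yv e , evalE V M e p

        consistent : Consistent (map pair P)
        consistent a∈ b∈ with ∈-map⁻ pair a∈ | ∈-map⁻ pair b∈
        ... | _ , a∈P , refl | _ , b∈P , refl = coherent a∈P b∈P

        φ : ∀ w → BV w → BV w
        φ = realise (map pair P)

        target : ∀ {w} → Tm V w → BV w
        target {w} t with evaluable? t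
        ... | yes p = evalE V M t p
        ... | no _  = φ w (eval V ρ yv t)

        target-evaluable : ∀ {w} (t : Tm V w) (p : Evaluable V t) → target t ≡ evalE V M t p
        target-evaluable t p with evaluable? t
        ... | yes q = trans (evalE≡eval M t q yv) (sym (evalE≡eval M t p yv))
        ... | no ¬p = ⊥-elim (¬p p)

        target-recorded : ∀ {w} {t : Tm V w} → Recorded P t → target t ≡ φ w (eval V ρ yv t)
        target-recorded {t = t} (inj₁ ¬p) with evaluable? t
        ... | yes p = ⊥-elim (¬p p)
        ... | no _  = refl
        target-recorded {t = t} (inj₂ (p , _ , e∈)) =
          trans (target-evaluable t p) (sym (realise-maps (map pair P) consistent (∈-map⁺ pair e∈)))

        countermodel : Σ (BV wy) λ y′ → ∀ ρ′ s → s ∈ Sl →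
                       eval V ρ′ y′ (sliceTm V s) ≡ target (G (sliceTm V s))
        countermodel = assemble Sl disjoint (λ s → target (G (sliceTm V s)))

        y′ : BV wy
        y′ = proj₁ countermodel

        side-value : ∀ {w} (u : Tm V w) → Side u → eval V M y′ u ≡ target (G u)
        side-value u (inj₁ (ev , _)) = begin
          eval V M y′ u        ≡⟨ rep-value graph-invariant u ev y′ ⟨
          eval V M y′ (G u)    ≡⟨ evalE≡eval M (G u) p y′ ⟨
          evalE V M (G u) p    ≡⟨ target-evaluable (G u) p ⟨
          target (G u)         ∎
          where p : Evaluable V (G u)
                p = rep-evaluable graph-invariant u ev
        side-value u (inj₂ (s , s∈ , e)) = subst OnSlice e (proj₂ countermodel M s s∈)
          where OnSlice : ATm V → Set
                OnSlice (_ , t) = eval V M y′ t ≡ target (G t)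

        Ê-true : All (HoldsEq V M y′) Ê
        Ê-true = All.zipWith holds (Ê-sides , run-identifies run)
          where
            holds : ∀ {e} → EqnOK V E D Sl e × ¬ ¬ (G (lhs V e) ≡ G (rhs V e)) → HoldsEq V M y′ e
            holds {w , t₁ , t₂} ((side₁ , side₂) , identified) = bv-stable λ ne → identified λ e →
              ne (trans (side-value t₁ side₁) (trans (cong target e) (sym (side-value t₂ side₂))))

        -- φ is injective and the handled disequality holds under ρ, so it holds at y′
        clause-true : ∀ {C} → C ∈ D̂ → Any (HoldsNeq V M y′) C
        clause-true C∈ with handled C∈
        ... | w , t₁ , t₂ , d∈ , h , r₁ , r₂ = lose d∈ λ e →
          separated ρ yv (proj₁ hF) h (realise-injective (map pair P) w (begin
            φ w (eval V ρ yv (G t₁))   ≡⟨ target-recorded r₁ ⟨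
            target (G t₁)              ≡⟨ side-value t₁ (proj₁ sides) ⟨
            eval V M y′ t₁             ≡⟨ e ⟩
            eval V M y′ t₂             ≡⟨ side-value t₂ (proj₂ sides) ⟩
            target (G t₂)              ≡⟨ target-recorded r₂ ⟩
            φ w (eval V ρ yv (G t₂))   ∎))
          where sides : EqnOK V E D Sl (w , t₁ , t₂)
                sides = All.lookup (All.lookup D̂-sides C∈) d∈

        D-true : All (HoldsNeq V M y′) D
        D-true = All.tabulate λ d∈ →
          let _ , C∈ , stands = pointwise-partner (Pointwiseₚ.symmetric id D∼D̂) d∈ in
          Equivalence.from (stands M y′) (clause-true C∈)

        impossible : ⊥
        impossible = unsatisfiable (y′ , Equivalence.from (E⇔Ê M y′) Ê-true , D-true)

      final-true : Out
      final-true with handle-all D̂ id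
      ... | inj₁ out = out
      ... | inj₂ (P , handled) with coherent-all P
      ... | inj₁ out      = out
      ... | inj₂ coherent = ⊥-elim (Countermodel.impossible P handled coherent)

    -- Claim (3).  It holds whether or not some clause has no interface and free
    -- disequalities.
    final-interpolant : Interpolant V E D M Final
    final-interpolant = (λ ρ yv hF → FinalEntailed.final-true ρ yv hF) , final-admissible , final-false

-- The theorem.
lemma1 : (V : Vars) (M : Asg V) (E D : List (Eqn V)) → ConflictCore V M E D →
    (Sl : List (Slice V)) (Ê : List (Eqn V)) (D̂ : List (List (Eqn V))) →
    SlicedForms V E D Sl Ê D̂ →
      (∀ {w} (t1′ t2′ : Tm V w) → RunA V M (idRep V) Ê (conflict t1′ t2′) →
         Interpolant V E D M (λ l → l ≡ (t1′ ≐ t2′)))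
    × (∀ (G : Rep V) → RunA V M (idRep V) Ê (graph G) →
         ∀ (pre : List (List (Eqn V))) (C : List (Eqn V)) (post : List (List (Eqn V))) →
         D̂ ≡ pre ++ˡ (C ∷ post) → All (λ C′ → ¬ NoIF V M Sl G C′) pre → NoIF V M Sl G C →
         Interpolant V E D M (CrepM V M Sl G C))
    × (∀ (G : Rep V) → RunA V M (idRep V) Ê (graph G) →
         All (λ C′ → ¬ NoIF V M Sl G C′) D̂ →
         Interpolant V E D M (FinalClause V M Sl G D̂))
lemma1 V M E D core Sl Ê D̂ sliced =
    conflict-interpolant
  , (λ G run pre C post D̂≡ _ noIF →
       WithGraph.stop-interpolant G run (subst (C ∈_) (sym D̂≡) (∈-++⁺ʳ pre (here refl))) noIF)
  , (λ G run _ → WithGraph.final-interpolant G run)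
  where open Main V M E D core Sl Ê D̂ sliced
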